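{- For any $\kappa\in\mathbb{Z}$ and any prime $p>3$, the graph $\mathcal{G}_\kappa(p)$ contains no subgraph isomorphic to the complete bipartite graph $K_{3,3}$.
   Context: Let $p>3$ be a prime and $\kappa\in\mathbb{Z}$, regarded as an element of $\mathbb{F}_p$. Let $\mathcal{M}_\kappa(p)=\{(x,y,z)\in\mathbb{F}_p^3 : x^2+y^2+z^2=xyz+\kappa\}$. The Vieta involutions are $R_1(x,y,z)=(yz-x,y,z)$, $R_2(x,y,z)=(x,zx-y,z)$, $R_3(x,y,z)=(x,y,xy-z)$; they preserve $\mathcal{M}_\kappa(p)$. The generalized Markoff mod $p$ graph $\mathcal{G}_\kappa(p)$ is the $3$-regular graph (possibly with loops) with vertex set $\mathcal{M}_\kappa(p)$, where for each vertex $X$ and each $i\in\{1,2,3\}$ there is an edge joining $X$ and $R_i(X)$ (a loop if $R_i(X)=X$); two triples are adjacent iff one is obtained from the other by some $R_i$. -}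

module Defs where

open import Data.Nat using (ℕ; _+_; _*_; _∸_; NonZero)
open import Data.Nat.DivMod using (_mod_)
open import Data.Integer using (ℤ)
open import Data.Integer.DivMod using (_%ℕ_)
open import Data.Fin using (Fin; toℕ)
open import Data.Product using (_×_; _,_; ∃-syntax)
open import Data.Sum using (_⊎_)
open import Relation.Binary.PropositionalEquality using (_≡_; _≢_)

module _ (p : ℕ) .{{_ : NonZero p}} where

  𝔽 : Set
  𝔽 = Fin p

  _⊕_ : 𝔽 → 𝔽 → 𝔽
  a ⊕ b = (toℕ a + toℕ b) mod p

  _⊗_ : 𝔽 → 𝔽 → 𝔽
  a ⊗ b = (toℕ a * toℕ b) mod p

  _⊖_ : 𝔽 → 𝔽 → 𝔽
  a ⊖ b = (toℕ a + (p ∸ toℕ b)) mod p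

  ι : ℤ → 𝔽
  ι κ = (κ %ℕ p) mod p

  Triple : Set
  Triple = 𝔽 × 𝔽 × 𝔽

  InM : ℤ → Triple → Set
  InM κ (x , y , z) = ((x ⊗ x) ⊕ (y ⊗ y)) ⊕ (z ⊗ z) ≡ ((x ⊗ y) ⊗ z) ⊕ ι κ

  R₁ R₂ R₃ : Triple → Triple
  R₁ (x , y , z) = ((y ⊗ z) ⊖ x , y , z)
  R₂ (x , y , z) = (x , (z ⊗ x) ⊖ y , z)
  R₃ (x , y , z) = (x , y , (x ⊗ y) ⊖ z)

  Adj : Triple → Triple → Set
  Adj X Y = (R₁ X ≡ Y ⊎ R₂ X ≡ Y ⊎ R₃ X ≡ Y) ⊎ (R₁ Y ≡ X ⊎ R₂ Y ≡ X ⊎ R₃ Y ≡ X)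

  -- A subgraph of G_κ(p) isomorphic to K_{3,3}: six pairwise distinct
  -- vertices of M_κ(p), a : Fin 3 → Triple and b : Fin 3 → Triple, with
  -- every a i adjacent to every b j.  (Since the six vertices are distinct,
  -- the nine edges a i — b j are automatically distinct non-loop edges.)
  record K33 (κ : ℤ) : Set where
    field
      a b      : Fin 3 → Triple
      a-in     : ∀ i → InM κ (a i)
      b-in     : ∀ j → InM κ (b j)
      a-inj    : ∀ i j → a i ≡ a j → i ≡ j
      b-inj    : ∀ i j → b i ≡ b j → i ≡ j
      a≢b      : ∀ i j → a i ≢ b j
      adj      : ∀ i j → Adj (a i) (b j)

module Submission where

-- Each Vieta involution Rᵢ changes only the i-th coordinate, and the old and
-- new values of that coordinate add up to the product of the other two.  So
-- every edge of the graph is labelled by the coordinate it changes, a vertex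
-- has at most one neighbour along each label, and an edge whose endpoints
-- agree in its label coordinate is a loop.  Around a 4-cycle of distinct
-- vertices a label occurring on a single edge would make that edge a loop,
-- while adjacent edges carry different labels; hence opposite edges carry the
-- same label.  In a K₃,₃ with sides {a₀, a₁, a₂} and {b₀, b₁, b₂}, the cycles
-- a₀ b₀ a₁ b₁ and a₀ b₀ a₂ b₁ give a₁ b₀ and a₂ b₀ the same label, so a₁ = a₂.

open import Defs
open import Data.Nat using (ℕ; _<_; NonZero)
open import Data.Nat.Primality using (Prime)
open import Data.Integer using (ℤ)
open import Relation.Nullary using (¬_)

open import Data.Nat using (_+_; _∸_; _%_)
open import Data.Nat.Properties using (+-comm; m+[n∸m]≡n; <⇒≤; +-commutativeSemigroup)
open import Algebra.Properties.CommutativeSemigroup +-commutativeSemigroup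
  using (x∙yz≈y∙xz; xy∙z≈y∙xz)
open import Data.Nat.DivMod using (_mod_; %-distribˡ-+; m%n%n≡m%n; [m+n]%n≡m%n; m<n⇒m%n≡m)
open import Data.Fin using (Fin; toℕ)
open import Data.Fin.Patterns using (0F; 1F; 2F)
open import Data.Fin.Properties using (toℕ-injective; toℕ-fromℕ<; toℕ<n; _≟_)
open import Data.Product using (_×_; _,_; ∃-syntax; proj₁; proj₂)
open import Data.Sum using (inj₁; inj₂)
open import Data.Empty using (⊥; ⊥-elim)
open import Relation.Nullary using (yes; no)
open import Relation.Nullary.Decidable using (decidable-stable)
open import Relation.Binary.PropositionalEquality

module _ {p : ℕ} .{{_ : NonZero p}} where

  private
    infixl 6 _+ₚ_ _-ₚ_
    infixl 7 _*ₚ_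

    _+ₚ_ _-ₚ_ _*ₚ_ : 𝔽 p → 𝔽 p → 𝔽 p
    _+ₚ_ = _⊕_ p
    _-ₚ_ = _⊖_ p
    _*ₚ_ = _⊗_ p

  toℕ-mod : ∀ n → toℕ (n mod p) ≡ n % p
  toℕ-mod n = toℕ-fromℕ< _

  toℕ%≡toℕ : (a : 𝔽 p) → toℕ a % p ≡ toℕ a
  toℕ%≡toℕ a = m<n⇒m%n≡m (toℕ<n a)

  toℕ+[p∸toℕ]≡p : (a : 𝔽 p) → toℕ a + (p ∸ toℕ a) ≡ p
  toℕ+[p∸toℕ]≡p a = m+[n∸m]≡n (<⇒≤ (toℕ<n a))

  [m+n%p]%p≡[m+n]%p : ∀ m n → (m + n % p) % p ≡ (m + n) % p
  [m+n%p]%p≡[m+n]%p m n = begin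
    (m + n % p) % p          ≡⟨ %-distribˡ-+ m (n % p) p ⟩
    (m % p + n % p % p) % p  ≡⟨ cong (λ t → (m % p + t) % p) (m%n%n≡m%n n p) ⟩
    (m % p + n % p) % p      ≡⟨ %-distribˡ-+ m n p ⟨
    (m + n) % p              ∎
    where open ≡-Reasoning

  [m%p+n]%p≡[m+n]%p : ∀ m n → (m % p + n) % p ≡ (m + n) % p
  [m%p+n]%p≡[m+n]%p m n = begin
    (m % p + n) % p  ≡⟨ cong (_% p) (+-comm (m % p) n) ⟩
    (n + m % p) % p  ≡⟨ [m+n%p]%p≡[m+n]%p n m ⟩
    (n + m) % p      ≡⟨ cong (_% p) (+-comm n m) ⟩
    (m + n) % p      ∎
    where open ≡-Reasoning

  ⊕-comm : (a b : 𝔽 p) → a +ₚ b ≡ b +ₚ a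
  ⊕-comm a b = cong (_mod p) (+-comm (toℕ a) (toℕ b))

  ⊕-⊖-cancel : (a c : 𝔽 p) → a +ₚ (c -ₚ a) ≡ c
  ⊕-⊖-cancel a c = toℕ-injective (begin
    toℕ (a +ₚ (c -ₚ a))          ≡⟨ toℕ-mod _ ⟩
    (A + toℕ (c -ₚ a)) % p       ≡⟨ cong (λ t → (A + t) % p) (toℕ-mod _) ⟩
    (A + (C + (p ∸ A)) % p) % p  ≡⟨ [m+n%p]%p≡[m+n]%p A _ ⟩
    (A + (C + (p ∸ A))) % p      ≡⟨ cong (_% p) (x∙yz≈y∙xz A C (p ∸ A)) ⟩
    (C + (A + (p ∸ A))) % p      ≡⟨ cong (λ t → (C + t) % p) (toℕ+[p∸toℕ]≡p a) ⟩
    (C + p) % p                  ≡⟨ [m+n]%n≡m%n C p ⟩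
    C % p                        ≡⟨ toℕ%≡toℕ c ⟩
    C                            ∎)
    where
    open ≡-Reasoning
    A = toℕ a
    C = toℕ c

  ⊖-⊕-cancel : (a b : 𝔽 p) → (a +ₚ b) -ₚ a ≡ b
  ⊖-⊕-cancel a b = toℕ-injective (begin
    toℕ ((a +ₚ b) -ₚ a)          ≡⟨ toℕ-mod _ ⟩
    (toℕ (a +ₚ b) + (p ∸ A)) % p ≡⟨ cong (λ t → (t + (p ∸ A)) % p) (toℕ-mod _) ⟩
    ((A + B) % p + (p ∸ A)) % p  ≡⟨ [m%p+n]%p≡[m+n]%p (A + B) _ ⟩
    ((A + B) + (p ∸ A)) % p      ≡⟨ cong (_% p) (xy∙z≈y∙xz A B (p ∸ A)) ⟩
    (B + (A + (p ∸ A))) % p      ≡⟨ cong (λ t → (B + t) % p) (toℕ+[p∸toℕ]≡p a) ⟩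
    (B + p) % p                  ≡⟨ [m+n]%n≡m%n B p ⟩
    B % p                        ≡⟨ toℕ%≡toℕ b ⟩
    B                            ∎)
    where
    open ≡-Reasoning
    A = toℕ a
    B = toℕ b

  ⊕-cancelˡ : (a b c : 𝔽 p) → a +ₚ b ≡ a +ₚ c → b ≡ c
  ⊕-cancelˡ a b c eq = begin
    b                ≡⟨ ⊖-⊕-cancel a b ⟨
    (a +ₚ b) -ₚ a    ≡⟨ cong (_-ₚ a) eq ⟩
    (a +ₚ c) -ₚ a    ≡⟨ ⊖-⊕-cancel a c ⟩
    c                ∎
    where open ≡-Reasoning

  coord : Fin 3 → Triple p → 𝔽 p
  coord 0F (x , _ , _) = x
  coord 1F (_ , y , _) = y
  coord 2F (_ , _ , z) = z

  rootSum : Fin 3 → Triple p → 𝔽 p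
  rootSum 0F (_ , y , z) = y *ₚ z
  rootSum 1F (x , _ , z) = z *ₚ x
  rootSum 2F (x , y , _) = x *ₚ y

  coord-ext : ∀ {X Y} → (∀ k → coord k X ≡ coord k Y) → X ≡ Y
  coord-ext {x , y , z} {x' , y' , z'} eq
    rewrite eq 0F | eq 1F | eq 2F = refl

  AgreeOff : Fin 3 → Triple p → Triple p → Set
  AgreeOff i X Y = ∀ k → k ≢ i → coord k X ≡ coord k Y

  rootSum-cong : ∀ i {X Y} → AgreeOff i X Y → rootSum i X ≡ rootSum i Y
  rootSum-cong 0F {_ , _ , _} {_ , _ , _} ag = cong₂ _*ₚ_ (ag 1F λ ()) (ag 2F λ ())
  rootSum-cong 1F {_ , _ , _} {_ , _ , _} ag = cong₂ _*ₚ_ (ag 2F λ ()) (ag 0F λ ())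
  rootSum-cong 2F {_ , _ , _} {_ , _ , _} ag = cong₂ _*ₚ_ (ag 0F λ ()) (ag 1F λ ())

  -- Y arises from X by a Vieta move in the i-th variable: the i-th
  -- coordinates of X and Y are the two roots of the quadratic in that variable.
  Vieta : Fin 3 → Triple p → Triple p → Set
  Vieta i X Y = coord i X +ₚ coord i Y ≡ rootSum i X × AgreeOff i X Y

  Vieta-sym : ∀ {i X Y} → Vieta i X Y → Vieta i Y X
  Vieta-sym {i} {X} {Y} (sum , ag) =
    trans (⊕-comm (coord i Y) (coord i X)) (trans sum (rootSum-cong i ag)) ,
    λ k k≢i → sym (ag k k≢i)

  Vieta-functional : ∀ {i X Y Y'} → Vieta i X Y → Vieta i X Y' → Y ≡ Y'
  Vieta-functional {i} {X} {Y} {Y'} (sum , ag) (sum' , ag') = coord-ext same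
    where
    same : ∀ k → coord k Y ≡ coord k Y'
    same k with k ≟ i
    ... | yes refl = ⊕-cancelˡ (coord i X) _ _ (trans sum (sym sum'))
    ... | no k≢i = trans (sym (ag k k≢i)) (ag' k k≢i)

  Vieta-coord≡⇒≡ : ∀ {i X Y} → Vieta i X Y → coord i X ≡ coord i Y → X ≡ Y
  Vieta-coord≡⇒≡ {i} {X} {Y} (_ , ag) eq = coord-ext same
    where
    same : ∀ k → coord k X ≡ coord k Y
    same k with k ≟ i
    ... | yes refl = eq
    ... | no k≢i = ag k k≢i

  R₁-Vieta : ∀ X → Vieta 0F X (R₁ p X)
  R₁-Vieta (x , y , z) = ⊕-⊖-cancel x (y *ₚ z) , λ { 0F 0≢0 → ⊥-elim (0≢0 refl) ; 1F _ → refl ; 2F _ → refl }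

  R₂-Vieta : ∀ X → Vieta 1F X (R₂ p X)
  R₂-Vieta (x , y , z) = ⊕-⊖-cancel y (z *ₚ x) , λ { 0F _ → refl ; 1F 1≢1 → ⊥-elim (1≢1 refl) ; 2F _ → refl }

  R₃-Vieta : ∀ X → Vieta 2F X (R₃ p X)
  R₃-Vieta (x , y , z) = ⊕-⊖-cancel z (x *ₚ y) , λ { 0F _ → refl ; 1F _ → refl ; 2F 2≢2 → ⊥-elim (2≢2 refl) }

  Adj⇒Vieta : ∀ {X Y} → Adj p X Y → ∃[ i ] Vieta i X Y
  Adj⇒Vieta {X} (inj₁ (inj₁ refl))        = 0F , R₁-Vieta X
  Adj⇒Vieta {X} (inj₁ (inj₂ (inj₁ refl))) = 1F , R₂-Vieta X
  Adj⇒Vieta {X} (inj₁ (inj₂ (inj₂ refl))) = 2F , R₃-Vieta X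
  Adj⇒Vieta {_} {Y} (inj₂ (inj₁ refl))        = 0F , Vieta-sym (R₁-Vieta Y)
  Adj⇒Vieta {_} {Y} (inj₂ (inj₂ (inj₁ refl))) = 1F , Vieta-sym (R₂-Vieta Y)
  Adj⇒Vieta {_} {Y} (inj₂ (inj₂ (inj₂ refl))) = 2F , Vieta-sym (R₃-Vieta Y)

  Vieta-labels-differ : ∀ {i j X Y Y'} → Vieta i X Y → Vieta j X Y' → Y ≢ Y' → i ≢ j
  Vieta-labels-differ e e' Y≢Y' refl = Y≢Y' (Vieta-functional e e')

  -- The closed walk X → Y → X' → Y' → X keeps coordinate i fixed outside its
  -- first edge, so that edge joins two triples with the same i-th coordinate.
  Vieta-cycle₄-lone-label : ∀ {i i' j' j X Y X' Y'} →
    Vieta i X Y → Vieta i' Y X' → Vieta j' X' Y' → Vieta j Y' X →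
    i ≢ i' → i ≢ j' → i ≢ j → X ≡ Y
  Vieta-cycle₄-lone-label {i} {X = X} {Y} {X'} {Y'} e (_ , agY) (_ , agX') (_ , agY') i≢i' i≢j' i≢j =
    Vieta-coord≡⇒≡ e (begin
      coord i X   ≡⟨ agY' i i≢j ⟨
      coord i Y'  ≡⟨ agX' i i≢j' ⟨
      coord i X'  ≡⟨ agY i i≢i' ⟨
      coord i Y   ∎)
    where open ≡-Reasoning

  Vieta-cycle₄-opposite-labels : ∀ {i i' j' j X Y X' Y'} →
    Vieta i X Y → Vieta i' Y X' → Vieta j' X' Y' → Vieta j Y' X →
    X ≢ X' → Y ≢ Y' → X ≢ Y → X ≢ Y' → i' ≡ j
  Vieta-cycle₄-opposite-labels {i} {i'} {j'} {j} e₁ e₂ e₃ e₄ X≢X' Y≢Y' X≢Y X≢Y' =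
    decidable-stable (i' ≟ j) i'≢j⇒⊥
    where
    i≢i' : i ≢ i'
    i≢i' = Vieta-labels-differ (Vieta-sym e₁) e₂ X≢X'
    i≢j : i ≢ j
    i≢j = Vieta-labels-differ e₁ (Vieta-sym e₄) Y≢Y'

    i'≢j⇒⊥ : i' ≢ j → ⊥
    i'≢j⇒⊥ i'≢j with i ≟ j'
    ... | no i≢j' = X≢Y (Vieta-cycle₄-lone-label e₁ e₂ e₃ e₄ i≢i' i≢j' i≢j)
    ... | yes i≡j' = X≢Y' (Vieta-cycle₄-lone-label
                             (Vieta-sym e₄) (Vieta-sym e₃) (Vieta-sym e₂) (Vieta-sym e₁)
                             (λ j≡j' → i≢j (trans i≡j' (sym j≡j'))) (≢-sym i'≢j) (≢-sym i≢j))

proposition3p1 : (κ : ℤ) (p : ℕ) .{{_ : NonZero p}} → Prime p → 3 < p → ¬ K33 p κ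
proposition3p1 κ p _ _ G =
  a-distinct {1F} {2F} (λ ())
    (Vieta-functional (Vieta-sym (edge 1F 0F))
                      (subst (λ t → Vieta t (b 0F) (a 2F)) label₂₀≡label₁₀ (Vieta-sym (edge 2F 0F))))
  where
  open K33 G

  label : Fin 3 → Fin 3 → Fin 3
  label i j = proj₁ (Adj⇒Vieta (adj i j))

  edge : ∀ i j → Vieta (label i j) (a i) (b j)
  edge i j = proj₂ (Adj⇒Vieta (adj i j))

  a-distinct : ∀ {i j} → i ≢ j → a i ≢ a j
  a-distinct i≢j aᵢ≡aⱼ = i≢j (a-inj _ _ aᵢ≡aⱼ)

  b-distinct : ∀ {i j} → i ≢ j → b i ≢ b j
  b-distinct i≢j bᵢ≡bⱼ = i≢j (b-inj _ _ bᵢ≡bⱼ)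

  labelᵢ₀≡label₀₁ : ∀ i → a 0F ≢ a i → label i 0F ≡ label 0F 1F
  labelᵢ₀≡label₀₁ i a₀≢aᵢ =
    Vieta-cycle₄-opposite-labels (edge 0F 0F) (Vieta-sym (edge i 0F)) (edge i 1F) (Vieta-sym (edge 0F 1F))
      a₀≢aᵢ (b-distinct λ ()) (a≢b 0F 0F) (a≢b 0F 1F)

  label₂₀≡label₁₀ : label 2F 0F ≡ label 1F 0F
  label₂₀≡label₁₀ = trans (labelᵢ₀≡label₀₁ 2F (a-distinct λ ())) (sym (labelᵢ₀≡label₀₁ 1F (a-distinct λ ())))
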